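{- Let $m_1,\ldots,m_n\ge 2$ be integers, let $\mathcal{B}\subseteq\{0,1\}^n$, and let $G=\mathrm{NEPS}(K_{m_1},\ldots,K_{m_n};\mathcal{B})$, where $K_m$ is the complete graph on $m$ vertices. Then for all vertices $v_i,v_j\in V(G)$ and every integer $r\ge1$, $$w_{G}(r,v_i,v_j)=\sum_{(\beta_1,\ldots,\beta_{r})\in \mathcal{B}^{r}}\ \prod_{t=1}^{n} a_{t}(v_i,v_j),$$ where, writing $\beta_\ell=(\beta_{\ell1},\ldots,\beta_{\ell n})$ and $s_t=\beta_{1t}+\cdots+\beta_{rt}$, $$a_{t}(v_{i},v_j)=\begin{cases} \frac{m_t-1}{m_t}\big((m_{t}-1)^{s_t-1}-(-1)^{s_t-1}\big) & \text{if } \pi_{t}(v_i)=\pi_t(v_j), \\[2mm] \frac{1}{m_t}\big((m_{t}-1)^{s_t}-(-1)^{s_t}\big) & \text{if } \pi_{t}(v_i)\neq\pi_t(v_j), \end{cases}$$ and $\pi_t:V(G)\to V(K_{m_t})$ is the projection onto the $t$-th coordinate.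
   Context: Given $\mathcal{B}\subseteq\{0,1\}^n$ and graphs $G_1,\ldots,G_n$, the NEPS $\mathrm{NEPS}(G_1,\ldots,G_n;\mathcal{B})$ is the graph with vertex set $V(G_1)\times\cdots\times V(G_n)$ in which $(x_1,\ldots,x_n)$ and $(y_1,\ldots,y_n)$ are adjacent if and only if there is $(\alpha_1,\ldots,\alpha_n)\in\mathcal{B}$ such that $x_i=y_i$ whenever $\alpha_i=0$, and $x_i,y_i$ are distinct and adjacent in $G_i$ whenever $\alpha_i=1$. $w_G(r,u,v)$ denotes the number of walks of length $r$ from $u$ to $v$ in $G$. -}

module Defs where

open import Data.Nat as ℕ using (ℕ; zero; suc)
open import Data.Integer as ℤ using (ℤ; +_; -[1+_])
open import Data.Rational as ℚ using (ℚ; 0ℚ; 1ℚ; _/_; 1/_)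
open import Data.Rational.Properties using () renaming (_≟_ to _≟ℚ_)
open import Data.Fin as Fin using (Fin; zero; suc)
open import Data.Fin.Properties using () renaming (_≟_ to _≟F_)
open import Data.Bool using (Bool; true; false; if_then_else_; _∧_; not)
open import Data.List as List using (List; []; _∷_; map; concatMap; foldr; filterᵇ)
open import Relation.Nullary.Decidable using (does; yes; no)
open import Relation.Binary.PropositionalEquality using (_≢_)
open import Data.Nat.ListAction using () renaming (sum to sumℕ)

allFin : (m : ℕ) → List (Fin m)
allFin m = List.allFin m

allBool : List Bool
allBool = false ∷ true ∷ []

allFuns : (n : ℕ) (A : Fin n → Set) → ((t : Fin n) → List (A t)) → List ((t : Fin n) → A t)
allFuns zero    A e = (λ ()) ∷ []
allFuns (suc n) A e =
  concatMap (λ a → map (λ f → cons a f) (allFuns n (λ t → A (suc t)) (λ t → e (suc t)))) (e zero)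
  where
  cons : A zero → ((t : Fin n) → A (suc t)) → (t : Fin (suc n)) → A t
  cons a f zero    = a
  cons a f (suc t) = f t

tuples : {A : Set} → ℕ → List A → List (List A)
tuples zero    xs = [] ∷ []
tuples (suc r) xs = concatMap (λ x → map (x ∷_) (tuples r xs)) xs

-- A basis B ⊆ {0,1}^n is given as a Boolean predicate on Fin n → Bool
-- (tuples α; true = 1, false = 0).

Vertex : (n : ℕ) → (Fin n → ℕ) → Set
Vertex n m = (t : Fin n) → Fin (m t)

BTuple : ℕ → Set
BTuple n = Fin n → Bool

allVertices : (n : ℕ) (m : Fin n → ℕ) → List (Vertex n m)
allVertices n m = allFuns n (λ t → Fin (m t)) (λ t → allFin (m t))

allBTuples : (n : ℕ) → List (BTuple n)
allBTuples n = allFuns n (λ _ → Bool) (λ _ → allBool)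

elemsB : (n : ℕ) → (BTuple n → Bool) → List (BTuple n)
elemsB n B = filterᵇ B (allBTuples n)

allᵇ : {A : Set} → (A → Bool) → List A → Bool
allᵇ p = foldr (λ x b → p x ∧ b) true

anyᵇ : {A : Set} → (A → Bool) → List A → Bool
anyᵇ p = foldr (λ x b → if p x then true else b) false

adjVia : (n : ℕ) (m : Fin n → ℕ) → BTuple n → Vertex n m → Vertex n m → Bool
adjVia n m α x y =
  allᵇ (λ i → if α i then not (does (x i ≟F y i)) else does (x i ≟F y i)) (List.allFin n)

adjNEPS : (n : ℕ) (m : Fin n → ℕ) → (BTuple n → Bool) → Vertex n m → Vertex n m → Bool
adjNEPS n m B x y = anyᵇ (λ α → B α ∧ adjVia n m α x y) (allBTuples n)

walks : (n : ℕ) (m : Fin n → ℕ) → (BTuple n → Bool) → ℕ → Vertex n m → Vertex n m → ℕ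
walks n m B zero    u v = if allᵇ (λ i → does (u i ≟F v i)) (List.allFin n) then 1 else 0
walks n m B (suc r) u v =
  sumℕ (map (λ w → if adjNEPS n m B u w then walks n m B r w v else 0) (allVertices n m))

sumℚ : List ℚ → ℚ
sumℚ = foldr ℚ._+_ 0ℚ

prodℚ : List ℚ → ℚ
prodℚ = foldr ℚ._*_ 1ℚ

_^ℕ_ : ℚ → ℕ → ℚ
p ^ℕ zero  = 1ℚ
p ^ℕ suc k = p ℚ.* (p ^ℕ k)

-- integer power in ℚ (p^(-k) = 1/p^k; junk value 0 for 0 to a negative power)
_^ℤ_ : ℚ → ℤ → ℚ
p ^ℤ (+ k) = p ^ℕ k
p ^ℤ -[1+ k ] with p ^ℕ suc k ≟ℚ 0ℚ
... | yes _ = 0ℚ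
... | no q≢0 = 1/_ (p ^ℕ suc k) {{ℚ.≢-nonZero q≢0}}

ℕ→ℚ : ℕ → ℚ
ℕ→ℚ k = (+ k) / 1

ℤ→ℚ : ℤ → ℚ
ℤ→ℚ k = k / 1

-- 1/m as a rational (m ≥ 2 in all uses; junk value 0 at m = 0)
inv : ℕ → ℚ
inv zero    = 0ℚ
inv (suc k) = (+ 1) / suc k

-- a_t for K_{m}, given whether π_t(v_i) = π_t(v_j) and s_t:
--   same:      (m-1)/m * ((m-1)^(s-1) - (-1)^(s-1))
--   different: 1/m     * ((m-1)^s     - (-1)^s)
-- exponents taken in ℤ (s - 1 = -1 when s = 0).
aCoeff : (m : ℕ) → Bool → ℕ → ℚ
aCoeff m true  s = (ℕ→ℚ (m ℕ.∸ 1) ℚ.* inv m) ℚ.*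
  ((ℕ→ℚ (m ℕ.∸ 1) ^ℤ ((+ s) ℤ.- (+ 1))) ℚ.- ((ℚ.- 1ℚ) ^ℤ ((+ s) ℤ.- (+ 1))))
aCoeff m false s = inv m ℚ.*
  ((ℕ→ℚ (m ℕ.∸ 1) ^ℕ s) ℚ.- ((ℚ.- 1ℚ) ^ℕ s))

sCount : {n : ℕ} → List (BTuple n) → Fin n → ℕ
sCount βs t = sumℕ (map (λ β → if β t then 1 else 0) βs)

rhs : (n : ℕ) (m : Fin n → ℕ) → (BTuple n → Bool) → ℕ → Vertex n m → Vertex n m → ℚ
rhs n m B r u v =
  sumℚ (map (λ βs → prodℚ (map (λ t → aCoeff (m t) (does (u t ≟F v t)) (sCount βs t))
                                (List.allFin n)))
            (tuples r (elemsB n B)))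

{-# OPTIONS --safe #-}
-- Two vertices u, w of the NEPS are adjacent through at most one α ∈ {0,1}ⁿ, namely α_t = [u_t ≠ w_t].
-- Hence a walk of length r is a sequence (β_1, …, β_r) ∈ Bʳ together with, independently in every
-- coordinate t, a walk in K_(m_t) that moves exactly at the s_t steps ℓ with β_ℓt = 1, so that
-- w_G(r, u, v) = Σ_(β ∈ Bʳ) Π_t w_(K_(m_t))(s_t, u_t, v_t). In K_m the counts S(s), D(s) of walks
-- between equal and distinct endpoints satisfy S(s+1) = (m-1) D(s) and D(s+1) = S(s) + (m-2) D(s),
-- whose solution is the stated a_t.
module Submission where

open import Defs
open import Data.Nat using (ℕ; zero; suc; _+_; _*_; _≤_; z≤n; s≤s)
open import Data.Empty using (⊥-elim)
open import Data.Nat.Properties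
  using (+-commutativeSemigroup; +-identityʳ; +-cancelˡ-≡; *-zeroʳ; *-distribˡ-+; *-distribʳ-+; suc-injective)
open import Algebra.Properties.CommutativeSemigroup +-commutativeSemigroup
  using (x∙yz≈y∙xz) renaming (interchange to +-interchange)
open import Data.Nat.ListAction using (sum; product)
open import Data.Nat.ListAction.Properties using (sum-++)
open import Data.Integer as ℤ using (ℤ; -[1+_])
import Data.Integer.Properties as ℤP
open import Data.Rational as ℚ using (ℚ; 0ℚ; 1ℚ; mkℚ)
import Data.Rational.Properties as ℚP
open import Data.Rational.Solver using (module +-*-Solver)
open import Data.Nat.Coprimality as Coprimality using (Coprime; 1-coprimeTo)
open import Data.Fin using (Fin; zero; suc)
open import Data.Fin.Properties using (_≟_)
open import Data.Bool using (Bool; true; false; if_then_else_; _∧_; not)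
open import Data.Bool.Properties using (∧-zeroʳ; if-∧)
open import Data.List using (List; []; _∷_; map; concatMap; filterᵇ; length; _++_)
open import Data.List.Properties using (map-cong; map-∘; map-++; map-tabulate; foldr-map; length-tabulate)
open import Relation.Nullary.Decidable using (Dec; does; yes; no; dec-true; dec-false)
open import Relation.Binary.PropositionalEquality
open import Function using (_∘_; id)

private variable
  A B : Set

∑ : List A → (A → ℕ) → ℕ
∑ xs f = sum (map f xs)

syntax ∑ xs (λ x → e) = ∑[ x ∈ xs ] e

Π : (n : ℕ) → (Fin n → ℕ) → ℕ
Π n f = product (map f (allFin n))

∑-cong : (xs : List A) {f g : A → ℕ} → (∀ x → f x ≡ g x) → ∑ xs f ≡ ∑ xs g
∑-cong xs f≗g = cong sum (map-cong f≗g xs)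

∑-zero : (xs : List A) → ∑[ _ ∈ xs ] 0 ≡ 0
∑-zero []       = refl
∑-zero (_ ∷ xs) = ∑-zero xs

∑-const : (xs : List A) (y : ℕ) → ∑[ _ ∈ xs ] y ≡ length xs * y
∑-const []       y = refl
∑-const (_ ∷ xs) y = cong (y +_) (∑-const xs y)

∑-+ : (xs : List A) (f g : A → ℕ) → ∑[ x ∈ xs ] (f x + g x) ≡ ∑ xs f + ∑ xs g
∑-+ []       f g = refl
∑-+ (x ∷ xs) f g = trans (cong (f x + g x +_) (∑-+ xs f g)) (+-interchange (f x) (g x) (∑ xs f) (∑ xs g))

∑-*ˡ : (c : ℕ) (xs : List A) (f : A → ℕ) → c * ∑ xs f ≡ ∑[ x ∈ xs ] (c * f x)
∑-*ˡ c []       f = *-zeroʳ c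
∑-*ˡ c (x ∷ xs) f = trans (*-distribˡ-+ c (f x) _) (cong (c * f x +_) (∑-*ˡ c xs f))

∑-*ʳ : (c : ℕ) (xs : List A) (f : A → ℕ) → ∑ xs f * c ≡ ∑[ x ∈ xs ] (f x * c)
∑-*ʳ c []       f = refl
∑-*ʳ c (x ∷ xs) f = trans (*-distribʳ-+ c (f x) _) (cong (f x * c +_) (∑-*ʳ c xs f))

∑-if : (b : Bool) (xs : List A) (f : A → ℕ) →
       (if b then ∑ xs f else 0) ≡ ∑[ x ∈ xs ] (if b then f x else 0)
∑-if true  xs f = refl
∑-if false xs f = sym (∑-zero xs)

∑-filterᵇ : (P : A → Bool) (xs : List A) (f : A → ℕ) →
            ∑ (filterᵇ P xs) f ≡ ∑[ x ∈ xs ] (if P x then f x else 0)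
∑-filterᵇ P []       f = refl
∑-filterᵇ P (x ∷ xs) f with P x
... | true  = cong (f x +_) (∑-filterᵇ P xs f)
... | false = ∑-filterᵇ P xs f

∑-++ : (xs ys : List A) (f : A → ℕ) → ∑ (xs ++ ys) f ≡ ∑ xs f + ∑ ys f
∑-++ xs ys f = trans (cong sum (map-++ f xs ys)) (sum-++ (map f xs) (map f ys))

∑-swap : (xs : List A) (ys : List B) (f : A → B → ℕ) →
         ∑[ x ∈ xs ] ∑ ys (f x) ≡ ∑[ y ∈ ys ] ∑[ x ∈ xs ] f x y
∑-swap []       ys f = sym (∑-zero ys)
∑-swap (x ∷ xs) ys f = trans (cong (∑ ys (f x) +_) (∑-swap xs ys f))
                             (sym (∑-+ ys (f x) (λ y → ∑[ x ∈ xs ] f x y)))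

∑-map : (g : A → B) (xs : List A) (f : B → ℕ) → ∑ (map g xs) f ≡ ∑ xs (f ∘ g)
∑-map g xs f = cong sum (sym (map-∘ xs))

∑-concatMap : (g : A → List B) (xs : List A) (f : B → ℕ) →
              ∑ (concatMap g xs) f ≡ ∑[ x ∈ xs ] ∑ (g x) f
∑-concatMap g []       f = refl
∑-concatMap g (x ∷ xs) f =
  trans (∑-++ (g x) (concatMap g xs) f) (cong (∑ (g x) f +_) (∑-concatMap g xs f))

allFin-suc : (n : ℕ) → allFin (suc n) ≡ zero ∷ map suc (allFin n)
allFin-suc n = cong (zero ∷_) (sym (map-tabulate id suc))

∑-allFin-suc : (n : ℕ) (f : Fin (suc n) → ℕ) → ∑ (allFin (suc n)) f ≡ f zero + ∑ (allFin n) (f ∘ suc)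
∑-allFin-suc n f = trans (cong (λ xs → ∑ xs f) (allFin-suc n)) (cong (f zero +_) (∑-map suc (allFin n) f))

∑-allFin-const : (n y : ℕ) → ∑[ _ ∈ allFin n ] y ≡ n * y
∑-allFin-const n y = trans (∑-const (allFin n) y) (cong (_* y) (length-tabulate {n = n} id))

Π-suc : (n : ℕ) (f : Fin (suc n) → ℕ) → Π (suc n) f ≡ f zero * Π n (f ∘ suc)
Π-suc n f = trans (cong (λ xs → product (map f xs)) (allFin-suc n))
                  (cong (λ xs → f zero * product xs) (sym (map-∘ (allFin n))))

Π-cong : (n : ℕ) {f g : Fin n → ℕ} → (∀ t → f t ≡ g t) → Π n f ≡ Π n g
Π-cong n f≗g = cong product (map-cong f≗g (allFin n))

Π-one : (n : ℕ) → Π n (λ _ → 1) ≡ 1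
Π-one zero    = refl
Π-one (suc n) = trans (Π-suc n (λ _ → 1)) (trans (+-identityʳ _) (Π-one n))

∑-concatMap-map : {C D : Set} (xs : List A) (ys : List C) (g : A → C → D)
                  (F : D → ℕ) (f : A → ℕ) (h : C → ℕ) →
                  (∀ x y → F (g x y) ≡ f x * h y) →
                  ∑ (concatMap (λ x → map (g x) ys) xs) F ≡ ∑ xs f * ∑ ys h
∑-concatMap-map xs ys g F f h F∘g≡f*h = begin
  ∑ (concatMap (λ x → map (g x) ys) xs) F  ≡⟨ ∑-concatMap (λ x → map (g x) ys) xs F ⟩
  ∑[ x ∈ xs ] ∑ (map (g x) ys) F          ≡⟨ ∑-cong xs (λ x → ∑-map (g x) ys F) ⟩
  ∑[ x ∈ xs ] ∑ ys (F ∘ g x)              ≡⟨ ∑-cong xs (λ x → ∑-cong ys (F∘g≡f*h x)) ⟩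
  ∑[ x ∈ xs ] ∑[ y ∈ ys ] (f x * h y)     ≡⟨ ∑-cong xs (λ x → ∑-*ˡ (f x) ys h) ⟨
  ∑[ x ∈ xs ] (f x * ∑ ys h)              ≡⟨ ∑-*ʳ (∑ ys h) xs f ⟨
  ∑ xs f * ∑ ys h                         ∎
  where open ≡-Reasoning

-- Π-suc for a dependent d, so that d can be inferred in ∑-allFuns-Π, where it is local to allFuns.
Π-suc-dep : (n : ℕ) {A : Fin (suc n) → Set} (h : (t : Fin (suc n)) → A t → ℕ) (d : (t : Fin (suc n)) → A t) →
            Π (suc n) (λ t → h t (d t)) ≡ h zero (d zero) * Π n (λ t → h (suc t) (d (suc t)))
Π-suc-dep n h d = Π-suc n (λ t → h t (d t))

∑-allFuns-Π : (n : ℕ) (A : Fin n → Set) (e : (t : Fin n) → List (A t)) (h : (t : Fin n) → A t → ℕ) →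
              ∑[ f ∈ allFuns n A e ] Π n (λ t → h t (f t)) ≡ Π n (λ t → ∑ (e t) (h t))
∑-allFuns-Π zero    A e h = refl
∑-allFuns-Π (suc n) A e h = begin
  ∑[ f ∈ allFuns (suc n) A e ] Π (suc n) (λ t → h t (f t))
    ≡⟨ ∑-concatMap-map (e zero) _ _ _ (h zero) _ (λ a f → Π-suc-dep n h _) ⟩
  ∑ (e zero) (h zero) * ∑[ f ∈ allFuns n (A ∘ suc) (e ∘ suc) ] Π n (λ t → h (suc t) (f t))
    ≡⟨ cong (∑ (e zero) (h zero) *_) (∑-allFuns-Π n (A ∘ suc) (e ∘ suc) (h ∘ suc)) ⟩
  ∑ (e zero) (h zero) * Π n (λ t → ∑ (e (suc t)) (h (suc t)))
    ≡⟨ Π-suc n (λ t → ∑ (e t) (h t)) ⟨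
  Π (suc n) (λ t → ∑ (e t) (h t))
    ∎
  where open ≡-Reasoning

allᵇ-suc : (n : ℕ) (p : Fin (suc n) → Bool) → allᵇ p (allFin (suc n)) ≡ p zero ∧ allᵇ (p ∘ suc) (allFin n)
allᵇ-suc n p = trans (cong (λ xs → allᵇ p xs) (allFin-suc n)) (cong (p zero ∧_) (foldr-map _ suc true (allFin n)))

if-∧-* : (a b : Bool) (x y : ℕ) → (if a ∧ b then x * y else 0) ≡ (if a then x else 0) * (if b then y else 0)
if-∧-* true  true  x y = refl
if-∧-* true  false x y = sym (*-zeroʳ x)
if-∧-* false b     x y = refl

Π-if-allᵇ : (n : ℕ) (p : Fin n → Bool) (F : Fin n → ℕ) →
            (if allᵇ p (allFin n) then Π n F else 0) ≡ Π n (λ t → if p t then F t else 0)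
Π-if-allᵇ zero    p F = refl
Π-if-allᵇ (suc n) p F = begin
  (if allᵇ p (allFin (suc n)) then Π (suc n) F else 0)
    ≡⟨ cong₂ (λ b x → if b then x else 0) (allᵇ-suc n p) (Π-suc n F) ⟩
  (if p zero ∧ allᵇ (p ∘ suc) (allFin n) then F zero * Π n (F ∘ suc) else 0)
    ≡⟨ if-∧-* (p zero) _ (F zero) _ ⟩
  (if p zero then F zero else 0) * (if allᵇ (p ∘ suc) (allFin n) then Π n (F ∘ suc) else 0)
    ≡⟨ cong ((if p zero then F zero else 0) *_) (Π-if-allᵇ n (p ∘ suc) (F ∘ suc)) ⟩
  (if p zero then F zero else 0) * Π n (λ t → if p (suc t) then F (suc t) else 0)
    ≡⟨ Π-suc n (λ t → if p t then F t else 0) ⟨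
  Π (suc n) (λ t → if p t then F t else 0)
    ∎
  where open ≡-Reasoning

module _ (P q : A → Bool) where

  anyᵇ-∧-none : (xs : List A) → ∑[ x ∈ xs ] (if q x then 1 else 0) ≡ 0 → anyᵇ (λ x → P x ∧ q x) xs ≡ false
  anyᵇ-∧-none []       _ = refl
  anyᵇ-∧-none (x ∷ xs) h with q x
  anyᵇ-∧-none (x ∷ xs) () | true
  ... | false rewrite ∧-zeroʳ (P x) = anyᵇ-∧-none xs h

  ∑-∧-none : (c : ℕ) (xs : List A) → ∑[ x ∈ xs ] (if q x then 1 else 0) ≡ 0 →
             ∑[ x ∈ xs ] (if P x ∧ q x then c else 0) ≡ 0
  ∑-∧-none c []       _ = refl
  ∑-∧-none c (x ∷ xs) h with q x
  ∑-∧-none c (x ∷ xs) () | true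
  ... | false rewrite ∧-zeroʳ (P x) = ∑-∧-none c xs h

  if-anyᵇ-∧-unique : (c : ℕ) (xs : List A) → ∑[ x ∈ xs ] (if q x then 1 else 0) ≡ 1 →
                     (if anyᵇ (λ x → P x ∧ q x) xs then c else 0) ≡ ∑[ x ∈ xs ] (if P x ∧ q x then c else 0)
  if-anyᵇ-∧-unique c (x ∷ xs) h with q x
  ... | false rewrite ∧-zeroʳ (P x) = if-anyᵇ-∧-unique c xs h
  ... | true with P x
  ...   | true  = sym (trans (cong (c +_) (∑-∧-none c xs (suc-injective h))) (+-identityʳ c))
  ...   | false rewrite anyᵇ-∧-none xs (suc-injective h) = sym (∑-∧-none c xs (suc-injective h))

-- adjVia n m α x y is the conjunction over t of stepVia (α t) (x t) (y t).
stepVia : {k : ℕ} → Bool → Fin k → Fin k → Bool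
stepVia moves a c = if moves then not (does (a ≟ c)) else does (a ≟ c)

∑-stepVia-one : {k : ℕ} (a c : Fin k) → ∑[ moves ∈ allBool ] (if stepVia moves a c then 1 else 0) ≡ 1
∑-stepVia-one a c with does (a ≟ c)
... | true  = refl
... | false = refl

adjVia-unique : (n : ℕ) (m : Fin n → ℕ) (u w : Vertex n m) →
                ∑[ α ∈ allBTuples n ] (if adjVia n m α u w then 1 else 0) ≡ 1
adjVia-unique n m u w = begin
  ∑[ α ∈ allBTuples n ] (if adjVia n m α u w then 1 else 0)
    ≡⟨ ∑-cong (allBTuples n) (λ α → cong (λ x → if adjVia n m α u w then x else 0) (Π-one n)) ⟨
  ∑[ α ∈ allBTuples n ] (if adjVia n m α u w then Π n (λ _ → 1) else 0)
    ≡⟨ ∑-cong (allBTuples n) (λ α → Π-if-allᵇ n (λ t → stepVia (α t) (u t) (w t)) (λ _ → 1)) ⟩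
  ∑[ α ∈ allBTuples n ] Π n (λ t → if stepVia (α t) (u t) (w t) then 1 else 0)
    ≡⟨ ∑-allFuns-Π n (λ _ → Bool) (λ _ → allBool) (λ t a → if stepVia a (u t) (w t) then 1 else 0) ⟩
  Π n (λ t → ∑[ a ∈ allBool ] (if stepVia a (u t) (w t) then 1 else 0))
    ≡⟨ Π-cong n (λ t → ∑-stepVia-one (u t) (w t)) ⟩
  Π n (λ _ → 1)
    ≡⟨ Π-one n ⟩
  1 ∎
  where open ≡-Reasoning

if-adjNEPS : (n : ℕ) (m : Fin n → ℕ) (B : BTuple n → Bool) (u w : Vertex n m) (c : ℕ) →
             (if adjNEPS n m B u w then c else 0) ≡ ∑[ α ∈ elemsB n B ] (if adjVia n m α u w then c else 0)
if-adjNEPS n m B u w c =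
  trans (if-anyᵇ-∧-unique B (λ α → adjVia n m α u w) c (allBTuples n) (adjVia-unique n m u w))
        (trans (∑-cong (allBTuples n) (λ α → if-∧ (B α)))
               (sym (∑-filterᵇ B (allBTuples n) (λ α → if adjVia n m α u w then c else 0))))

∑-adjVia-Π : (n : ℕ) (m : Fin n → ℕ) (α : BTuple n) (u : Vertex n m) (F : (t : Fin n) → Fin (m t) → ℕ) →
             ∑[ w ∈ allVertices n m ] (if adjVia n m α u w then Π n (λ t → F t (w t)) else 0)
             ≡ Π n (λ t → ∑[ c ∈ allFin (m t) ] (if stepVia (α t) (u t) c then F t c else 0))
∑-adjVia-Π n m α u F =
  trans (∑-cong (allVertices n m) (λ w → Π-if-allᵇ n (λ t → stepVia (α t) (u t) (w t)) (λ t → F t (w t))))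
        (∑-allFuns-Π n (λ t → Fin (m t)) (λ t → allFin (m t)) (λ t c → if stepVia (α t) (u t) c then F t c else 0))

walksK : (m : ℕ) → ℕ → Fin m → Fin m → ℕ
walksK m zero    a b = if does (a ≟ b) then 1 else 0
walksK m (suc s) a b = ∑[ c ∈ allFin m ] (if not (does (a ≟ c)) then walksK m s c b else 0)

∑-pick : (m : ℕ) (a : Fin m) (g : Fin m → ℕ) → ∑[ c ∈ allFin m ] (if does (a ≟ c) then g c else 0) ≡ g a
∑-pick (suc m) zero    g = trans (∑-allFin-suc m (λ c → if does (zero ≟ c) then g c else 0))
                                 (trans (cong (g zero +_) (∑-zero (allFin m))) (+-identityʳ (g zero)))
∑-pick (suc m) (suc a) g = trans (∑-allFin-suc m (λ c → if does (suc a ≟ c) then g c else 0)) (∑-pick m a (g ∘ suc))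

∑-split : (m : ℕ) (a : Fin m) (g : Fin m → ℕ) →
          ∑ (allFin m) g ≡ g a + ∑[ c ∈ allFin m ] (if not (does (a ≟ c)) then g c else 0)
∑-split m a g = trans (∑-cong (allFin m) split)
                      (trans (∑-+ (allFin m) on off) (cong (_+ ∑ (allFin m) off) (∑-pick m a g)))
  where
  on off : Fin m → ℕ
  on  c = if does (a ≟ c) then g c else 0
  off c = if not (does (a ≟ c)) then g c else 0
  split : ∀ c → g c ≡ on c + off c
  split c with does (a ≟ c)
  ... | true  = sym (+-identityʳ (g c))
  ... | false = refl

∑-≢-const : (k : ℕ) (a : Fin (suc k)) (y : ℕ) →
            ∑[ c ∈ allFin (suc k) ] (if not (does (a ≟ c)) then y else 0) ≡ k * y
∑-≢-const k a y = +-cancelˡ-≡ y _ _ (trans (sym (∑-split (suc k) a (λ _ → y))) (∑-allFin-const (suc k) y))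

∑-stepVia-walksK : (m : ℕ) (moves : Bool) (s : ℕ) (a b : Fin m) →
                   ∑[ c ∈ allFin m ] (if stepVia moves a c then walksK m s c b else 0)
                   ≡ walksK m ((if moves then 1 else 0) + s) a b
∑-stepVia-walksK m true  s a b = refl
∑-stepVia-walksK m false s a b = ∑-pick m a (λ c → walksK m s c b)

-- Walk counts of K_(q+2); indexing by q builds in m ≥ 2.
mutual
  sameEnd : ℕ → ℕ → ℕ
  sameEnd q zero    = 1
  sameEnd q (suc s) = suc q * distinctEnd q s

  distinctEnd : ℕ → ℕ → ℕ
  distinctEnd q zero    = 0
  distinctEnd q (suc s) = sameEnd q s + q * distinctEnd q s

off-diagonal : {k : ℕ} (b c : Fin k) (x y : ℕ) →
               (if not (does (b ≟ c)) then (if does (c ≟ b) then x else y) else 0)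
               ≡ (if not (does (b ≟ c)) then y else 0)
off-diagonal b c x y with b ≟ c
... | yes _   = refl
... | no b≢c rewrite dec-false (c ≟ b) (b≢c ∘ sym) = refl

walksK-closed : (q s : ℕ) (a b : Fin (suc (suc q))) →
                walksK (suc (suc q)) s a b ≡ (if does (a ≟ b) then sameEnd q s else distinctEnd q s)
walksK-closed q zero    a b with does (a ≟ b)
... | true  = refl
... | false = refl
walksK-closed q (suc s) a b =
  trans (∑-cong (allFin M) (λ c → cong (λ x → if not (does (a ≟ c)) then x else 0) (walksK-closed q s c b)))
        (count (a ≟ b))
  where
  M S F : ℕ
  M = suc (suc q)
  S = sameEnd q s
  F = distinctEnd q s
  h : Fin M → ℕ
  h c = if does (c ≟ b) then S else F
  count : (a≟b : Dec (a ≡ b)) → ∑[ c ∈ allFin M ] (if not (does (a ≟ c)) then h c else 0)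
                                ≡ (if does a≟b then sameEnd q (suc s) else distinctEnd q (suc s))
  count (yes refl) = trans (∑-cong (allFin M) (λ c → off-diagonal a c S F)) (∑-≢-const (suc q) a F)
  count (no a≢b)   = +-cancelˡ-≡ F _ _ (begin
    F + X                ≡⟨ cong (λ d → (if d then S else F) + X) (dec-false (a ≟ b) a≢b) ⟨
    h a + X              ≡⟨ ∑-split M a h ⟨
    ∑ (allFin M) h       ≡⟨ ∑-split M b h ⟩
    h b + ∑[ c ∈ allFin M ] (if not (does (b ≟ c)) then h c else 0)
                         ≡⟨ cong₂ _+_ (cong (λ d → if d then S else F) (dec-true (b ≟ b) refl))
                                      (trans (∑-cong (allFin M) (λ c → off-diagonal b c S F)) (∑-≢-const (suc q) b F)) ⟩
    S + (F + q * F)      ≡⟨ x∙yz≈y∙xz S F (q * F) ⟩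
    F + (S + q * F)      ∎)
    where
    open ≡-Reasoning
    X : ℕ
    X = ∑[ c ∈ allFin M ] (if not (does (a ≟ c)) then h c else 0)

walksAlong : (n : ℕ) (m : Fin n → ℕ) → List (BTuple n) → Vertex n m → Vertex n m → ℕ
walksAlong n m βs u v = Π n (λ t → walksK (m t) (sCount βs t) (u t) (v t))

walksAlong-∷ : (n : ℕ) (m : Fin n → ℕ) (α : BTuple n) (βs : List (BTuple n)) (u v : Vertex n m) →
               ∑[ w ∈ allVertices n m ] (if adjVia n m α u w then walksAlong n m βs w v else 0)
               ≡ walksAlong n m (α ∷ βs) u v
walksAlong-∷ n m α βs u v =
  trans (∑-adjVia-Π n m α u (λ t c → walksK (m t) (sCount βs t) c (v t)))
        (Π-cong n (λ t → ∑-stepVia-walksK (m t) (α t) (sCount βs t) (u t) (v t)))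

walks-≡-∑-walksAlong : (n : ℕ) (m : Fin n → ℕ) (B : BTuple n → Bool) (r : ℕ) (u v : Vertex n m) →
                       walks n m B r u v ≡ ∑[ βs ∈ tuples r (elemsB n B) ] walksAlong n m βs u v
walks-≡-∑-walksAlong n m B zero u v =
  trans (cong (λ x → if allᵇ (λ t → does (u t ≟ v t)) (allFin n) then x else 0) (sym (Π-one n)))
        (trans (Π-if-allᵇ n (λ t → does (u t ≟ v t)) (λ _ → 1)) (sym (+-identityʳ _)))
walks-≡-∑-walksAlong n m B (suc r) u v = begin
  ∑[ w ∈ V ] (if adjNEPS n m B u w then walks n m B r w v else 0)
    ≡⟨ ∑-cong V (λ w → if-adjNEPS n m B u w (walks n m B r w v)) ⟩
  ∑[ w ∈ V ] ∑[ α ∈ E ] (if adjVia n m α u w then walks n m B r w v else 0)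
    ≡⟨ ∑-swap V E (λ w α → if adjVia n m α u w then walks n m B r w v else 0) ⟩
  ∑[ α ∈ E ] ∑[ w ∈ V ] (if adjVia n m α u w then walks n m B r w v else 0)
    ≡⟨ ∑-cong E first-step ⟩
  ∑[ α ∈ E ] ∑[ βs ∈ T ] walksAlong n m (α ∷ βs) u v
    ≡⟨ ∑-cong E (λ α → ∑-map (α ∷_) T (λ βs → walksAlong n m βs u v)) ⟨
  ∑[ α ∈ E ] ∑[ βs ∈ map (α ∷_) T ] walksAlong n m βs u v
    ≡⟨ ∑-concatMap (λ α → map (α ∷_) T) E (λ βs → walksAlong n m βs u v) ⟨
  ∑[ βs ∈ tuples (suc r) E ] walksAlong n m βs u v
    ∎
  where
  open ≡-Reasoning
  V : List (Vertex n m)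
  V = allVertices n m
  E : List (BTuple n)
  E = elemsB n B
  T : List (List (BTuple n))
  T = tuples r E
  first-step : ∀ α → ∑[ w ∈ V ] (if adjVia n m α u w then walks n m B r w v else 0)
                     ≡ ∑[ βs ∈ T ] walksAlong n m (α ∷ βs) u v
  first-step α = begin
    ∑[ w ∈ V ] (if adjVia n m α u w then walks n m B r w v else 0)
      ≡⟨ ∑-cong V (λ w → cong (λ x → if adjVia n m α u w then x else 0) (walks-≡-∑-walksAlong n m B r w v)) ⟩
    ∑[ w ∈ V ] (if adjVia n m α u w then ∑[ βs ∈ T ] walksAlong n m βs w v else 0)
      ≡⟨ ∑-cong V (λ w → ∑-if (adjVia n m α u w) T (λ βs → walksAlong n m βs w v)) ⟩
    ∑[ w ∈ V ] ∑[ βs ∈ T ] (if adjVia n m α u w then walksAlong n m βs w v else 0)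
      ≡⟨ ∑-swap V T (λ w βs → if adjVia n m α u w then walksAlong n m βs w v else 0) ⟩
    ∑[ βs ∈ T ] ∑[ w ∈ V ] (if adjVia n m α u w then walksAlong n m βs w v else 0)
      ≡⟨ ∑-cong T (λ βs → walksAlong-∷ n m α βs u v) ⟩
    ∑[ βs ∈ T ] walksAlong n m (α ∷ βs) u v
      ∎

coprime-1 : (n : ℕ) → Coprime n 1
coprime-1 n = Coprimality.sym (1-coprimeTo n)

ℤ→ℚ-≡-mkℚ : (i : ℤ) → ℤ→ℚ i ≡ mkℚ i 0 (coprime-1 ℤ.∣ i ∣)
ℤ→ℚ-≡-mkℚ (ℤ.+ n)    = ℚP.normalize-coprime (coprime-1 n)
ℤ→ℚ-≡-mkℚ -[1+ n ]  = cong ℚ.-_ (ℚP.normalize-coprime (coprime-1 (suc n)))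

ℤ→ℚ-+ : (i j : ℤ) → ℤ→ℚ (i ℤ.+ j) ≡ ℤ→ℚ i ℚ.+ ℤ→ℚ j
ℤ→ℚ-+ i j = trans (cong (ℚ._/ 1) (cong₂ ℤ._+_ (sym (ℤP.*-identityʳ i)) (sym (ℤP.*-identityʳ j))))
                  (sym (cong₂ ℚ._+_ (ℤ→ℚ-≡-mkℚ i) (ℤ→ℚ-≡-mkℚ j)))

ℤ→ℚ-* : (i j : ℤ) → ℤ→ℚ (i ℤ.* j) ≡ ℤ→ℚ i ℚ.* ℤ→ℚ j
ℤ→ℚ-* i j = sym (cong₂ ℚ._*_ (ℤ→ℚ-≡-mkℚ i) (ℤ→ℚ-≡-mkℚ j))

ℕ→ℚ-+ : (a b : ℕ) → ℕ→ℚ (a + b) ≡ ℕ→ℚ a ℚ.+ ℕ→ℚ b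
ℕ→ℚ-+ a b = ℤ→ℚ-+ (ℤ.+ a) (ℤ.+ b)

ℕ→ℚ-* : (a b : ℕ) → ℕ→ℚ (a * b) ≡ ℕ→ℚ a ℚ.* ℕ→ℚ b
ℕ→ℚ-* a b = trans (cong ℤ→ℚ (ℤP.pos-* a b)) (ℤ→ℚ-* (ℤ.+ a) (ℤ.+ b))

ℕ→ℚ-∑ : (f : A → ℕ) (xs : List A) → ℕ→ℚ (∑ xs f) ≡ sumℚ (map (ℕ→ℚ ∘ f) xs)
ℕ→ℚ-∑ f []       = refl
ℕ→ℚ-∑ f (x ∷ xs) = trans (ℕ→ℚ-+ (f x) (∑ xs f)) (cong (ℕ→ℚ (f x) ℚ.+_) (ℕ→ℚ-∑ f xs))

ℕ→ℚ-product : (f : A → ℕ) (xs : List A) → ℕ→ℚ (product (map f xs)) ≡ prodℚ (map (ℕ→ℚ ∘ f) xs)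
ℕ→ℚ-product f []       = refl
ℕ→ℚ-product f (x ∷ xs) = trans (ℕ→ℚ-* (f x) _) (cong (ℕ→ℚ (f x) ℚ.*_) (ℕ→ℚ-product f xs))

ℕ→ℚ-suc≢0 : (k : ℕ) → ℕ→ℚ (suc k) ≢ 0ℚ
ℕ→ℚ-suc≢0 k eq with cong ℚ.numerator (trans (sym (ℤ→ℚ-≡-mkℚ (ℤ.+ suc k))) eq)
... | ()

inv-*-ℕ→ℚ : (k : ℕ) → inv (suc k) ℚ.* ℕ→ℚ (suc k) ≡ 1ℚ
inv-*-ℕ→ℚ k = trans (cong₂ ℚ._*_ (ℚP.normalize-coprime {1} {k} (1-coprimeTo (suc k)))
                                  (ℤ→ℚ-≡-mkℚ (ℤ.+ suc k)))
                    (ℚP.*-inverseˡ (mkℚ (ℤ.+ suc k) 0 (coprime-1 (suc k))))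

^ℤ-inverse : (p : ℚ) → p ≢ 0ℚ → (p ^ℤ -[1+ 0 ]) ℚ.* p ≡ 1ℚ
^ℤ-inverse p p≢0 with p ^ℕ 1 ℚP.≟ 0ℚ
... | yes p¹≡0 = ⊥-elim (p≢0 (trans (sym (ℚP.*-identityʳ p)) p¹≡0))
... | no  p¹≢0 = trans (cong (ℚ.1/_ (p ^ℕ 1) {{nz}} ℚ.*_) (sym (ℚP.*-identityʳ p)))
                      (ℚP.*-inverseˡ (p ^ℕ 1) {{nz}})
  where
  nz : ℚ.NonZero (p ^ℕ 1)
  nz = ℚ.≢-nonZero p¹≢0

open +-*-Solver using (solve; _:+_; _:*_; _:-_; con; _:=_)

module _ (q : ℕ) where

  private
    M : ℕ
    M = suc (suc q)

    P Q i : ℚ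
    P = ℕ→ℚ (suc q)
    Q = ℕ→ℚ q
    i = inv M

    P≡1+Q : P ≡ 1ℚ ℚ.+ Q
    P≡1+Q = ℕ→ℚ-+ 1 q

    i*[1+P]≡1 : i ℚ.* (1ℚ ℚ.+ P) ≡ 1ℚ
    i*[1+P]≡1 = trans (cong (i ℚ.*_) (sym (ℕ→ℚ-+ 1 (suc q)))) (inv-*-ℕ→ℚ (suc q))

  -- P and -1 are the roots of x² = Q x + P.
  aCoeff-distinct-recurrence : (k : ℕ) →
    aCoeff M false (suc (suc k)) ≡ P ℚ.* aCoeff M false k ℚ.+ Q ℚ.* aCoeff M false (suc k)
  aCoeff-distinct-recurrence k = identity P (P ^ℕ k) ((ℚ.- 1ℚ) ^ℕ k) P≡1+Q
    where
    identity : (P x y : ℚ) → P ≡ 1ℚ ℚ.+ Q →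
      i ℚ.* (P ℚ.* (P ℚ.* x) ℚ.- (ℚ.- 1ℚ) ℚ.* ((ℚ.- 1ℚ) ℚ.* y))
      ≡ P ℚ.* (i ℚ.* (x ℚ.- y)) ℚ.+ Q ℚ.* (i ℚ.* (P ℚ.* x ℚ.- (ℚ.- 1ℚ) ℚ.* y))
    identity .(1ℚ ℚ.+ Q) x y refl = solve 4 (λ Q i x y →
        i :* ((con 1ℚ :+ Q) :* ((con 1ℚ :+ Q) :* x) :- con (ℚ.- 1ℚ) :* (con (ℚ.- 1ℚ) :* y))
      := (con 1ℚ :+ Q) :* (i :* (x :- y)) :+ Q :* (i :* ((con 1ℚ :+ Q) :* x :- con (ℚ.- 1ℚ) :* y)))
      refl Q i x y

  distinctEnd-ℚ : (k : ℕ) → ℕ→ℚ (distinctEnd q k) ≡ aCoeff M false k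
  distinctEnd-ℚ zero          = sym (ℚP.*-zeroʳ i)
  distinctEnd-ℚ (suc zero)    = begin
    ℕ→ℚ (1 + q * 0)                               ≡⟨ cong (λ x → ℕ→ℚ (1 + x)) (*-zeroʳ q) ⟩
    1ℚ                                            ≡⟨ i*[1+P]≡1 ⟨
    i ℚ.* (1ℚ ℚ.+ P)                              ≡⟨ solve 2 (λ i P → i :* (con 1ℚ :+ P)
                                                       := i :* (P :* con 1ℚ :- con (ℚ.- 1ℚ) :* con 1ℚ)) refl i P ⟩
    i ℚ.* (P ℚ.* 1ℚ ℚ.- (ℚ.- 1ℚ) ℚ.* 1ℚ)          ∎
    where open ≡-Reasoning
  distinctEnd-ℚ (suc (suc k)) = begin
    ℕ→ℚ (suc q * distinctEnd q k + q * distinctEnd q (suc k))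
      ≡⟨ trans (ℕ→ℚ-+ (suc q * distinctEnd q k) (q * distinctEnd q (suc k)))
               (cong₂ ℚ._+_ (ℕ→ℚ-* (suc q) (distinctEnd q k)) (ℕ→ℚ-* q (distinctEnd q (suc k)))) ⟩
    P ℚ.* ℕ→ℚ (distinctEnd q k) ℚ.+ Q ℚ.* ℕ→ℚ (distinctEnd q (suc k))
      ≡⟨ cong₂ (λ x y → P ℚ.* x ℚ.+ Q ℚ.* y) (distinctEnd-ℚ k) (distinctEnd-ℚ (suc k)) ⟩
    P ℚ.* aCoeff M false k ℚ.+ Q ℚ.* aCoeff M false (suc k)
      ≡⟨ aCoeff-distinct-recurrence k ⟨
    aCoeff M false (suc (suc k))
      ∎
    where open ≡-Reasoning

  sameEnd-ℚ : (k : ℕ) → ℕ→ℚ (sameEnd q k) ≡ aCoeff M true k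
  -- At k = 0 the exponent k - 1 of aCoeff is -1, so the inverse of P enters.
  sameEnd-ℚ zero    = begin
    1ℚ                                     ≡⟨ i*[1+P]≡1 ⟨
    i ℚ.* (1ℚ ℚ.+ P)                       ≡⟨ solve 2 (λ i P → i :* (con 1ℚ :+ P) := P :* i :+ i :* con 1ℚ) refl i P ⟩
    P ℚ.* i ℚ.+ i ℚ.* 1ℚ                   ≡⟨ cong (λ x → P ℚ.* i ℚ.+ i ℚ.* x) (^ℤ-inverse P (ℕ→ℚ-suc≢0 q)) ⟨
    P ℚ.* i ℚ.+ i ℚ.* (R ℚ.* P)            ≡⟨ solve 3 (λ i P R → P :* i :+ i :* (R :* P)
                                                := (P :* i) :* (R :- con (ℚ.- 1ℚ))) refl i P R ⟩
    (P ℚ.* i) ℚ.* (R ℚ.- (ℚ.- 1ℚ))         ∎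
    where
    open ≡-Reasoning
    R : ℚ
    R = P ^ℤ -[1+ 0 ]
  sameEnd-ℚ (suc k) = begin
    ℕ→ℚ (suc q * distinctEnd q k)          ≡⟨ ℕ→ℚ-* (suc q) (distinctEnd q k) ⟩
    P ℚ.* ℕ→ℚ (distinctEnd q k)            ≡⟨ cong (P ℚ.*_) (distinctEnd-ℚ k) ⟩
    P ℚ.* (i ℚ.* (P ^ℕ k ℚ.- (ℚ.- 1ℚ) ^ℕ k)) ≡⟨ ℚP.*-assoc P i _ ⟨
    aCoeff M true (suc k)                   ∎
    where open ≡-Reasoning

walksK-ℚ : (m : ℕ) → 2 ≤ m → (s : ℕ) (a b : Fin m) → ℕ→ℚ (walksK m s a b) ≡ aCoeff m (does (a ≟ b)) s
walksK-ℚ (suc (suc q)) (s≤s (s≤s z≤n)) s a b with does (a ≟ b) | walksK-closed q s a b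
... | true  | eq = trans (cong ℕ→ℚ eq) (sameEnd-ℚ q s)
... | false | eq = trans (cong ℕ→ℚ eq) (distinctEnd-ℚ q s)

walksAlong-ℚ : (n : ℕ) (m : Fin n → ℕ) → (∀ t → 2 ≤ m t) → (βs : List (BTuple n)) (u v : Vertex n m) →
               ℕ→ℚ (walksAlong n m βs u v)
               ≡ prodℚ (map (λ t → aCoeff (m t) (does (u t ≟ v t)) (sCount βs t)) (allFin n))
walksAlong-ℚ n m 2≤m βs u v =
  trans (ℕ→ℚ-product (λ t → walksK (m t) (sCount βs t) (u t) (v t)) (allFin n))
        (cong prodℚ (map-cong (λ t → walksK-ℚ (m t) (2≤m t) (sCount βs t) (u t) (v t)) (allFin n)))

corollary3p2 : (n : ℕ) (m : Fin n → ℕ) → (∀ t → 2 ≤ m t) →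
    (B : BTuple n → Bool) → (u v : Vertex n m) → (r : ℕ) → 1 ≤ r →
    ℕ→ℚ (walks n m B r u v) ≡ rhs n m B r u v
corollary3p2 n m 2≤m B u v r _ = begin
  ℕ→ℚ (walks n m B r u v)                            ≡⟨ cong ℕ→ℚ (walks-≡-∑-walksAlong n m B r u v) ⟩
  ℕ→ℚ (∑[ βs ∈ T ] walksAlong n m βs u v)            ≡⟨ ℕ→ℚ-∑ (λ βs → walksAlong n m βs u v) T ⟩
  sumℚ (map (λ βs → ℕ→ℚ (walksAlong n m βs u v)) T)
    ≡⟨ cong sumℚ (map-cong (λ βs → walksAlong-ℚ n m 2≤m βs u v) T) ⟩
  rhs n m B r u v                                    ∎
  where
  open ≡-Reasoning
  T : List (List (BTuple n))
  T = tuples r (elemsB n B)
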